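{- Let $G$ be a finite simple graph, let $n\ge 0$ be even, let $v_1,\dots,v_n$ be (not necessarily distinct) vertices of $G$, and let $\{u,v\}\in E(G)$. Then $\mathrm{pm}_{G[uv]}(v_1,\dots,v_n)=\mathrm{pm}_G(v_1,\dots,v_n,u,v)$.
   Context: $x\sim_H y$ holds iff $\{x,y\}\in E(H)$ or $x=y$. For an even $m\ge0$ and (not necessarily distinct) vertices $w_1,\dots,w_m$, $\mathrm{pm}_H(w_1,\dots,w_m)=\bigoplus_P\bigwedge_{\{i,j\}\in P}(w_i\sim_H w_j)$, $P$ ranging over partitions of $\{1,\dots,m\}$ into 2-element sets ($\oplus$ = exclusive or; value true for $m=0$). Pivot: with $N'(x)=N(x)\cup\{x\}$, $V_1=N'(u)\setminus N'(v)$, $V_2=N'(v)\setminus N'(u)$, $V_3=N'(u)\cap N'(v)$, the graph $G[uv]$ is obtained from $G$ by toggling every pair $\{x,y\}$ with $x\in V_i$, $y\in V_j$, $i\neq j$. -}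

module Defs where

open import Data.Nat using (ℕ; zero; suc)
open import Data.Fin using (Fin; zero; suc)
open import Data.Fin.Properties using (_≟_)
open import Data.Bool using (Bool; true; false; _∧_; _∨_; not; _xor_; if_then_else_)
open import Data.List using (List; []; _∷_; concatMap; map; foldr; length)
open import Data.Vec using (Vec; []; _∷_; lookup; allFin)
open import Data.Product using (_×_; _,_)
open import Relation.Nullary.Decidable using (⌊_⌋)
open import Relation.Binary.PropositionalEquality using (_≡_; refl)

record SimpleGraph (k : ℕ) : Set where
  field
    adj    : Fin k → Fin k → Bool
    sym    : ∀ x y → adj x y ≡ adj y x
    irrefl : ∀ x → adj x x ≡ false
open SimpleGraph public

_∼[_]_ : ∀ {k} → Fin k → SimpleGraph k → Fin k → Bool
x ∼[ H ] y = adj H x y ∨ ⌊ x ≟ y ⌋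

picks : ∀ {A : Set} {n} → Vec A (suc n) → List (A × Vec A n)
picks (x ∷ []) = (x , []) ∷ []
picks (x ∷ y ∷ xs) = (x , y ∷ xs) ∷ map (λ { (z , r) → (z , x ∷ r) }) (picks (y ∷ xs))

-- all partitions of the entries of a vector into 2-element blocks
-- (each partition listed exactly once: the first entry is paired with each other entry)
pairings : ∀ {A : Set} {n} → Vec A n → List (List (A × A))
pairings [] = [] ∷ []
pairings (x ∷ []) = []
pairings (x ∷ y ∷ xs) =
  concatMap (λ { (z , r) → map ((x , z) ∷_) (pairings r) }) (picks (y ∷ xs))

pm : ∀ {k m} → SimpleGraph k → Vec (Fin k) m → Bool
pm {m = m} H w =
  foldr _xor_ false
    (map (λ P → foldr _∧_ true (map (λ { (i , j) → lookup w i ∼[ H ] lookup w j }) P)) (pairings (allFin m)))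

-- Pivot class: V₁ = N'(u)∖N'(v), V₂ = N'(v)∖N'(u), V₃ = N'(u)∩N'(v); 0 = none.
data Cls : Set where
  none c1 c2 c3 : Cls

cls : ∀ {k} → SimpleGraph k → Fin k → Fin k → Fin k → Cls
cls G u v x with u ∼[ G ] x | v ∼[ G ] x
... | true  | false = c1
... | false | true  = c2
... | true  | true  = c3
... | false | false = none

differ : Cls → Cls → Bool
differ none _ = false
differ _ none = false
differ c1 c1 = false
differ c2 c2 = false
differ c3 c3 = false
differ _ _ = true

differ-sym : ∀ a b → differ a b ≡ differ b a
differ-sym none none = refl
differ-sym none c1 = refl
differ-sym none c2 = refl
differ-sym none c3 = refl
differ-sym c1 none = refl
differ-sym c1 c1 = refl
differ-sym c1 c2 = refl
differ-sym c1 c3 = refl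
differ-sym c2 none = refl
differ-sym c2 c1 = refl
differ-sym c2 c2 = refl
differ-sym c2 c3 = refl
differ-sym c3 none = refl
differ-sym c3 c1 = refl
differ-sym c3 c2 = refl
differ-sym c3 c3 = refl

differ-refl : ∀ a → differ a a ≡ false
differ-refl none = refl
differ-refl c1 = refl
differ-refl c2 = refl
differ-refl c3 = refl

private
  xor-sym : ∀ a b c d → a ≡ b → c ≡ d → (a xor c) ≡ (b xor d)
  xor-sym a .a c .c refl refl = refl

  xor-ff : ∀ a b → a ≡ false → b ≡ false → (a xor b) ≡ false
  xor-ff .false .false refl refl = refl

pivot : ∀ {k} → SimpleGraph k → Fin k → Fin k → SimpleGraph k
pivot G u v = record
  { adj    = λ x y → adj G x y xor differ (cls G u v x) (cls G u v y)
  ; sym    = λ x y → xor-sym _ _ _ _ (sym G x y) (differ-sym (cls G u v x) (cls G u v y))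
  ; irrefl = λ x → xor-ff _ _ (irrefl G x) (differ-refl (cls G u v x))
  }

module Submission where

-- Over GF(2), pm_H(w) is the hafnian of the matrix (w_i ∼_H w_j), so it obeys
-- the Laplace-type recursion  hf(x ∷ l) = ⊕_i (x ∼ l_i) · hf(l ∖ l_i).  Three facts about it then give the theorem:
--   * hf is invariant under permutations of its argument list;
--   * a rank-two update M' = M + abᵀ + baᵀ changes hf(l) by hf₂ a b (l), the
--     hafnian of l with two virtual vertices of rows a, b not paired together;
--   * expanding hf(u ∷ v ∷ l) along u gives (u ∼ v)·hf(l) ⊕ hf₂ (u∼) (v∼) (l).
-- Finally pm is identified with hf, and the pivot G[uv] is exactly the rank-two
-- update of ∼_G with a = (u ∼_G ·), b = (v ∼_G ·).

open import Defs
open import Data.Nat using (ℕ; zero; suc; _+_; ⌊_/2⌋)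
open import Data.Nat.Divisibility using (_∣_)
open import Data.Nat.Properties using (+-comm)
open import Data.Fin using (Fin)
open import Data.Fin.Properties using (_≟_)
open import Data.Bool using (Bool; true; false; _∧_; _∨_; _xor_)
open import Data.Bool.Properties
  using (xor-assoc; xor-same; xor-identityʳ; ∧-comm; ∧-assoc; ∧-zeroʳ; ∧-distribˡ-xor;
         ∧-distribʳ-xor; ∨-zeroʳ; ∨-identityʳ; xor-∧-commutativeRing; ∧-commutativeMonoid)
open import Data.List using (List; []; _∷_; map; foldr; concatMap) renaming (_++_ to _++ˡ_)
open import Data.List.Properties using (map-++; map-∘; map-cong)
open import Data.List.Relation.Binary.Permutation.Propositional using (_↭_; refl; prep; swap; trans)
open import Data.List.Relation.Binary.Permutation.Propositional.Properties using (++-comm)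
open import Data.Vec using (Vec; _++_; _∷_; []; toList; lookup; allFin)
import Data.Vec as Vec
open import Data.Vec.Properties using (toList-map; map-lookup-allFin; toList-++)
open import Data.Product using (_×_; _,_; proj₁; proj₂)
open import Relation.Binary.PropositionalEquality
  using (_≡_; refl; cong; cong₂; module ≡-Reasoning)
  renaming (sym to ≡-sym; trans to ≡-trans)
open import Relation.Nullary using (yes; no; contradiction)
open import Relation.Nullary.Decidable using (⌊_⌋)
open import Algebra.Bundles using (CommutativeRing; CommutativeMonoid)
import Algebra.Properties.CommutativeSemigroup as CommSemigroupProperties

open CommSemigroupProperties (CommutativeRing.+-commutativeSemigroup xor-∧-commutativeRing)
  using () renaming (interchange to xor-interchange; x∙yz≈y∙xz to xor-left-comm)
open CommSemigroupProperties (CommutativeMonoid.commutativeSemigroup ∧-commutativeMonoid)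
  using () renaming (x∙yz≈y∙xz to ∧-left-comm)

expand : ∀ {X : Set} → (X → Bool) → (List X → Bool) → List X → Bool
expand ρ F []      = false
expand ρ F (x ∷ l) = (ρ x ∧ F l) xor expand ρ (λ r → F (x ∷ r)) l

module Expansion {X : Set} where

  expand-cong : ∀ {ρ ρ' : X → Bool} {F F' : List X → Bool} →
    (∀ z → ρ z ≡ ρ' z) → (∀ r → F r ≡ F' r) → ∀ l → expand ρ F l ≡ expand ρ' F' l
  expand-cong eρ eF []      = refl
  expand-cong eρ eF (x ∷ l) =
    cong₂ _xor_ (cong₂ _∧_ (eρ x) (eF l)) (expand-cong eρ (λ r → eF (x ∷ r)) l)

  expand-xorᶠ : ∀ (ρ : X → Bool) (F G : List X → Bool) l →
    expand ρ (λ r → F r xor G r) l ≡ expand ρ F l xor expand ρ G l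
  expand-xorᶠ ρ F G []      = refl
  expand-xorᶠ ρ F G (x ∷ l) = begin
    (ρ x ∧ (F l xor G l)) xor expand ρ (λ r → F (x ∷ r) xor G (x ∷ r)) l
      ≡⟨ cong₂ _xor_ (∧-distribˡ-xor (ρ x) (F l) (G l))
                     (expand-xorᶠ ρ (λ r → F (x ∷ r)) (λ r → G (x ∷ r)) l) ⟩
    ((ρ x ∧ F l) xor (ρ x ∧ G l)) xor (expand ρ _ l xor expand ρ _ l)
      ≡⟨ xor-interchange (ρ x ∧ F l) (ρ x ∧ G l) (expand ρ (λ r → F (x ∷ r)) l) (expand ρ (λ r → G (x ∷ r)) l) ⟩
    expand ρ F (x ∷ l) xor expand ρ G (x ∷ l) ∎
    where open ≡-Reasoning

  expand-scaleᶠ : ∀ (ρ : X → Bool) (c : Bool) (F : List X → Bool) l →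
    expand ρ (λ r → c ∧ F r) l ≡ c ∧ expand ρ F l
  expand-scaleᶠ ρ c F []      = ≡-sym (∧-zeroʳ c)
  expand-scaleᶠ ρ c F (x ∷ l) = begin
    (ρ x ∧ (c ∧ F l)) xor expand ρ (λ r → c ∧ F (x ∷ r)) l
      ≡⟨ cong₂ _xor_ (∧-left-comm (ρ x) c (F l)) (expand-scaleᶠ ρ c (λ r → F (x ∷ r)) l) ⟩
    (c ∧ (ρ x ∧ F l)) xor (c ∧ expand ρ (λ r → F (x ∷ r)) l)
      ≡⟨ ≡-sym (∧-distribˡ-xor c _ _) ⟩
    c ∧ expand ρ F (x ∷ l) ∎
    where open ≡-Reasoning

  expand-false : ∀ (ρ : X → Bool) l → expand ρ (λ _ → false) l ≡ false
  expand-false ρ = expand-scaleᶠ ρ false (λ _ → true)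

  expand-xorʳ : ∀ (ρ σ : X → Bool) (F : List X → Bool) l →
    expand (λ z → ρ z xor σ z) F l ≡ expand ρ F l xor expand σ F l
  expand-xorʳ ρ σ F []      = refl
  expand-xorʳ ρ σ F (x ∷ l) = begin
    ((ρ x xor σ x) ∧ F l) xor expand (λ z → ρ z xor σ z) (λ r → F (x ∷ r)) l
      ≡⟨ cong₂ _xor_ (∧-distribʳ-xor (F l) (ρ x) (σ x)) (expand-xorʳ ρ σ (λ r → F (x ∷ r)) l) ⟩
    ((ρ x ∧ F l) xor (σ x ∧ F l)) xor (expand ρ _ l xor expand σ _ l)
      ≡⟨ xor-interchange (ρ x ∧ F l) (σ x ∧ F l) (expand ρ (λ r → F (x ∷ r)) l) (expand σ (λ r → F (x ∷ r)) l) ⟩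
    expand ρ F (x ∷ l) xor expand σ F (x ∷ l) ∎
    where open ≡-Reasoning

  expand-scaleʳ : ∀ (c : Bool) (ρ : X → Bool) (F : List X → Bool) l →
    expand (λ z → c ∧ ρ z) F l ≡ c ∧ expand ρ F l
  expand-scaleʳ c ρ F []      = ≡-sym (∧-zeroʳ c)
  expand-scaleʳ c ρ F (x ∷ l) = begin
    ((c ∧ ρ x) ∧ F l) xor expand (λ z → c ∧ ρ z) (λ r → F (x ∷ r)) l
      ≡⟨ cong₂ _xor_ (∧-assoc c (ρ x) (F l)) (expand-scaleʳ c ρ (λ r → F (x ∷ r)) l) ⟩
    (c ∧ (ρ x ∧ F l)) xor (c ∧ expand ρ (λ r → F (x ∷ r)) l)
      ≡⟨ ≡-sym (∧-distribˡ-xor c _ _) ⟩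
    c ∧ expand ρ F (x ∷ l) ∎
    where open ≡-Reasoning

  expand-update : ∀ {ρ' : X → Bool} (ρ σ τ : X → Bool) (c d : Bool) →
    (∀ z → ρ' z ≡ ρ z xor ((c ∧ σ z) xor (d ∧ τ z))) → ∀ (F : List X → Bool) l →
    expand ρ' F l ≡ expand ρ F l xor ((c ∧ expand σ F l) xor (d ∧ expand τ F l))
  expand-update ρ σ τ c d eρ F l = begin
    expand _ F l
      ≡⟨ expand-cong eρ (λ _ → refl) l ⟩
    expand (λ z → ρ z xor ((c ∧ σ z) xor (d ∧ τ z))) F l
      ≡⟨ expand-xorʳ ρ _ F l ⟩
    expand ρ F l xor expand (λ z → (c ∧ σ z) xor (d ∧ τ z)) F l
      ≡⟨ cong (expand ρ F l xor_) (expand-xorʳ _ _ F l) ⟩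
    expand ρ F l xor (expand (λ z → c ∧ σ z) F l xor expand (λ z → d ∧ τ z) F l)
      ≡⟨ cong (expand ρ F l xor_) (cong₂ _xor_ (expand-scaleʳ c σ F l) (expand-scaleʳ d τ F l)) ⟩
    expand ρ F l xor ((c ∧ expand σ F l) xor (d ∧ expand τ F l)) ∎
    where open ≡-Reasoning

  -- Pulling the first entry x out of an inner expansion: in the inner sum x is
  -- either the removed entry (contributing σ x) or stays in the remainder.
  expand-peel : ∀ (ρ σ : X → Bool) (F : List X → Bool) x l →
    expand ρ (λ r → expand σ F (x ∷ r)) l
      ≡ (σ x ∧ expand ρ F l) xor expand ρ (expand σ (λ r → F (x ∷ r))) l
  expand-peel ρ σ F x l =
    ≡-trans (expand-xorᶠ ρ (λ r → σ x ∧ F r) _ l)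
            (cong (_xor expand ρ (expand σ (λ r → F (x ∷ r))) l) (expand-scaleᶠ ρ (σ x) F l))

  expand-swap : ∀ (ρ σ : X → Bool) (F : List X → Bool) l →
    expand ρ (expand σ F) l ≡ expand σ (expand ρ F) l
  expand-swap ρ σ F []      = refl
  expand-swap ρ σ F (x ∷ l) = begin
    (ρ x ∧ expand σ F l) xor expand ρ (λ r → expand σ F (x ∷ r)) l
      ≡⟨ cong ((ρ x ∧ expand σ F l) xor_) (expand-peel ρ σ F x l) ⟩
    (ρ x ∧ expand σ F l) xor ((σ x ∧ expand ρ F l) xor expand ρ (expand σ Fx) l)
      ≡⟨ cong (λ t → (ρ x ∧ expand σ F l) xor ((σ x ∧ expand ρ F l) xor t)) (expand-swap ρ σ Fx l) ⟩
    (ρ x ∧ expand σ F l) xor ((σ x ∧ expand ρ F l) xor expand σ (expand ρ Fx) l)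
      ≡⟨ xor-left-comm (ρ x ∧ expand σ F l) (σ x ∧ expand ρ F l) (expand σ (expand ρ Fx) l) ⟩
    (σ x ∧ expand ρ F l) xor ((ρ x ∧ expand σ F l) xor expand σ (expand ρ Fx) l)
      ≡⟨ cong ((σ x ∧ expand ρ F l) xor_) (≡-sym (expand-peel σ ρ F x l)) ⟩
    (σ x ∧ expand ρ F l) xor expand σ (λ r → expand ρ F (x ∷ r)) l ∎
    where
    open ≡-Reasoning
    Fx : List X → Bool
    Fx r = F (x ∷ r)

  -- Removing two entries with the same row counts every unordered pair twice.
  expand-diag : ∀ (ρ : X → Bool) (F : List X → Bool) l → expand ρ (expand ρ F) l ≡ false
  expand-diag ρ F []      = refl
  expand-diag ρ F (x ∷ l) = begin
    (ρ x ∧ expand ρ F l) xor expand ρ (λ r → expand ρ F (x ∷ r)) l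
      ≡⟨ cong ((ρ x ∧ expand ρ F l) xor_) (expand-peel ρ ρ F x l) ⟩
    (ρ x ∧ expand ρ F l) xor ((ρ x ∧ expand ρ F l) xor expand ρ (expand ρ (λ r → F (x ∷ r))) l)
      ≡⟨ ≡-sym (xor-assoc (ρ x ∧ expand ρ F l) _ _) ⟩
    ((ρ x ∧ expand ρ F l) xor (ρ x ∧ expand ρ F l)) xor expand ρ (expand ρ (λ r → F (x ∷ r))) l
      ≡⟨ cong₂ _xor_ (xor-same (ρ x ∧ expand ρ F l)) (expand-diag ρ (λ r → F (x ∷ r)) l) ⟩
    false ∎
    where open ≡-Reasoning

  expand-↭ : ∀ (ρ : X → Bool) {F : List X → Bool} →
    (∀ {r r'} → r ↭ r' → F r ≡ F r') → ∀ {l l'} → l ↭ l' → expand ρ F l ≡ expand ρ F l'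
  expand-↭ ρ resp refl          = refl
  expand-↭ ρ resp (trans p q)   = ≡-trans (expand-↭ ρ resp p) (expand-↭ ρ resp q)
  expand-↭ ρ resp (prep x p)    =
    cong₂ _xor_ (cong (ρ x ∧_) (resp p)) (expand-↭ ρ (λ q → resp (prep x q)) p)
  expand-↭ ρ {F} resp (swap {xs} {ys} x y p) = begin
    (ρ x ∧ F (y ∷ xs)) xor ((ρ y ∧ F (x ∷ xs)) xor expand ρ (λ r → F (x ∷ y ∷ r)) xs)
      ≡⟨ cong₂ (λ s t → (ρ x ∧ s) xor ((ρ y ∧ t) xor expand ρ (λ r → F (x ∷ y ∷ r)) xs))
               (resp (prep y p)) (resp (prep x p)) ⟩
    (ρ x ∧ F (y ∷ ys)) xor ((ρ y ∧ F (x ∷ ys)) xor expand ρ (λ r → F (x ∷ y ∷ r)) xs)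
      ≡⟨ cong (λ t → (ρ x ∧ F (y ∷ ys)) xor ((ρ y ∧ F (x ∷ ys)) xor t))
              (≡-trans (expand-↭ ρ (λ q → resp (prep x (prep y q))) p)
                       (expand-cong (λ _ → refl) (λ r → resp (swap x y refl)) ys)) ⟩
    (ρ x ∧ F (y ∷ ys)) xor ((ρ y ∧ F (x ∷ ys)) xor expand ρ (λ r → F (y ∷ x ∷ r)) ys)
      ≡⟨ xor-left-comm (ρ x ∧ F (y ∷ ys)) (ρ y ∧ F (x ∷ ys)) (expand ρ (λ r → F (y ∷ x ∷ r)) ys) ⟩
    (ρ y ∧ F (x ∷ ys)) xor ((ρ x ∧ F (y ∷ ys)) xor expand ρ (λ r → F (y ∷ x ∷ r)) ys) ∎
    where open ≡-Reasoning

  expand-map : ∀ {Y : Set} (h : X → Y) (ρ : Y → Bool) (F : List Y → Bool) l →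
    expand (λ z → ρ (h z)) (λ r → F (map h r)) l ≡ expand ρ F (map h l)
  expand-map h ρ F []      = refl
  expand-map h ρ F (x ∷ l) = cong ((ρ (h x) ∧ F (map h l)) xor_) (expand-map h ρ (λ r → F (h x ∷ r)) l)

open Expansion

-- The GF(2) hafnian of a list with respect to a Boolean matrix M, computed with
-- recursion depth k (the number of pairs; enough whenever the list has ≤ 2k entries).
-- hf₁ ρ k l is the hafnian of l with one extra virtual vertex of adjacency row ρ,
-- hf₂ ρ σ k l the one with two virtual vertices, which are never paired together.
module Hafnian {X : Set} (M : X → X → Bool) where

  mutual
    hf : ℕ → List X → Bool
    hf k []      = true
    hf k (x ∷ l) = hf₁ (M x) k l

    hf₁ : (X → Bool) → ℕ → List X → Bool
    hf₁ ρ zero    l = false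
    hf₁ ρ (suc k) l = expand ρ (hf k) l

  hf₂ : (X → Bool) → (X → Bool) → ℕ → List X → Bool
  hf₂ ρ σ k = expand ρ (hf₁ σ k)

  hf₂-sym : ∀ ρ σ k l → hf₂ ρ σ k l ≡ hf₂ σ ρ k l
  hf₂-sym ρ σ zero    l = ≡-trans (expand-false ρ l) (≡-sym (expand-false σ l))
  hf₂-sym ρ σ (suc k) l = expand-swap ρ σ (hf k) l

  hf₃-rotate : ∀ ρ σ τ k l → expand ρ (hf₂ σ τ k) l ≡ expand τ (hf₂ ρ σ k) l
  hf₃-rotate ρ σ τ k l = begin
    expand ρ (expand σ (hf₁ τ k)) l  ≡⟨ expand-cong (λ _ → refl) (λ r → hf₂-sym σ τ k r) l ⟩
    expand ρ (expand τ (hf₁ σ k)) l  ≡⟨ expand-swap ρ τ (hf₁ σ k) l ⟩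
    expand τ (expand ρ (hf₁ σ k)) l  ∎
    where open ≡-Reasoning

  hf₃-repeat : ∀ ρ σ k l → expand σ (hf₂ ρ σ k) l ≡ false
  hf₃-repeat ρ σ k l = ≡-trans (expand-cong (λ _ → refl) (λ r → hf₂-sym ρ σ k r) l)
                               (expand-diag σ (hf₁ ρ k) l)

  -- The two virtual vertices with rows ρ, σ and a real first vertex x:
  -- x is paired with the first, with the second, or with another real vertex.
  hf₂-cons : ∀ ρ σ k x l →
    hf₂ ρ σ (suc k) (x ∷ l)
      ≡ (ρ x ∧ hf₁ σ (suc k) l) xor ((σ x ∧ hf₁ ρ (suc k) l) xor expand (M x) (hf₂ ρ σ k) l)
  hf₂-cons ρ σ k x l = cong ((ρ x ∧ hf₁ σ (suc k) l) xor_) (begin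
    expand ρ (λ r → expand σ (hf k) (x ∷ r)) l
      ≡⟨ expand-peel ρ σ (hf k) x l ⟩
    (σ x ∧ expand ρ (hf k) l) xor expand ρ (hf₂ σ (M x) k) l
      ≡⟨ cong ((σ x ∧ expand ρ (hf k) l) xor_) (hf₃-rotate ρ σ (M x) k l) ⟩
    (σ x ∧ hf₁ ρ (suc k) l) xor expand (M x) (hf₂ ρ σ k) l ∎)
    where open ≡-Reasoning

  module Symmetric (M-sym : ∀ x y → M x y ≡ M y x) where

    hf-transpose : ∀ k x y l → hf k (x ∷ y ∷ l) ≡ hf k (y ∷ x ∷ l)
    hf-transpose zero    x y l = refl
    hf-transpose (suc k) x y l =
      cong₂ _xor_ (cong (_∧ hf k l) (M-sym x y)) (hf₂-sym (M x) (M y) k l)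

    mutual
      hf-↭ : ∀ k {l l'} → l ↭ l' → hf k l ≡ hf k l'
      hf-↭ k refl                   = refl
      hf-↭ k (trans p q)            = ≡-trans (hf-↭ k p) (hf-↭ k q)
      hf-↭ k (prep x p)             = hf₁-↭ (M x) k p
      hf-↭ k (swap {ys = ys} x y p) = ≡-trans (hf₁-↭ (M x) k (prep y p)) (hf-transpose k x y ys)

      hf₁-↭ : ∀ ρ k {l l'} → l ↭ l' → hf₁ ρ k l ≡ hf₁ ρ k l'
      hf₁-↭ ρ zero    p = refl
      hf₁-↭ ρ (suc k) p = expand-↭ ρ (hf-↭ k) p

module Relabel {X Y : Set} (M : X → X → Bool) (h : Y → X) where

  open Hafnian M
  module Pullback = Hafnian (λ a b → M (h a) (h b))

  mutual
    hf-map : ∀ k l → Pullback.hf k l ≡ hf k (map h l)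
    hf-map k []      = refl
    hf-map k (x ∷ l) = hf₁-map (M (h x)) k l

    hf₁-map : ∀ ρ k l → Pullback.hf₁ (λ z → ρ (h z)) k l ≡ hf₁ ρ k (map h l)
    hf₁-map ρ zero    l = refl
    hf₁-map ρ (suc k) l =
      ≡-trans (expand-cong (λ _ → refl) (hf-map k) l) (expand-map h ρ (hf k) l)

module RankTwo {X : Set} (M M' : X → X → Bool) (a b : X → Bool)
  (M'-def : ∀ x z → M' x z ≡ M x z xor ((a x ∧ b z) xor (b x ∧ a z))) where

  open Hafnian M
  module H' = Hafnian M'

  rank-two-update : ∀ k l → H'.hf k l ≡ hf k l xor hf₂ a b k l
  rank-two-update k       []      = refl
  rank-two-update zero    (x ∷ l) = ≡-sym (expand-false a (x ∷ l))
  rank-two-update (suc k) (x ∷ l) = begin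
    expand (M' x) (H'.hf k) l
      ≡⟨ expand-cong (λ _ → refl) (rank-two-update k) l ⟩
    expand (M' x) (λ r → hf k r xor hf₂ a b k r) l
      ≡⟨ expand-xorᶠ (M' x) (hf k) (hf₂ a b k) l ⟩
    expand (M' x) (hf k) l xor expand (M' x) (hf₂ a b k) l
      ≡⟨ cong₂ _xor_ (update (hf k)) (update (hf₂ a b k)) ⟩
    (H xor ((a x ∧ B) xor (b x ∧ A)))
      xor (Q xor ((a x ∧ expand b (hf₂ a b k) l) xor (b x ∧ expand a (hf₂ a b k) l)))
      ≡⟨ cong (λ t → (H xor ((a x ∧ B) xor (b x ∧ A))) xor t) vanish ⟩
    (H xor ((a x ∧ B) xor (b x ∧ A))) xor Q
      ≡⟨ ≡-trans (xor-assoc H _ Q) (cong (H xor_) (xor-assoc (a x ∧ B) _ Q)) ⟩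
    H xor ((a x ∧ B) xor ((b x ∧ A) xor Q))
      ≡⟨ cong (H xor_) (≡-sym (hf₂-cons a b k x l)) ⟩
    hf (suc k) (x ∷ l) xor hf₂ a b (suc k) (x ∷ l) ∎
    where
    open ≡-Reasoning
    H A B Q : Bool
    H = expand (M x) (hf k) l
    A = expand a (hf k) l
    B = expand b (hf k) l
    Q = expand (M x) (hf₂ a b k) l
    update : ∀ F → expand (M' x) F l ≡ expand (M x) F l xor ((a x ∧ expand b F l) xor (b x ∧ expand a F l))
    update F = expand-update (M x) b a (a x) (b x) (M'-def x) F l
    vanish : Q xor ((a x ∧ expand b (hf₂ a b k) l) xor (b x ∧ expand a (hf₂ a b k) l)) ≡ Q
    vanish = begin
      Q xor ((a x ∧ expand b (hf₂ a b k) l) xor (b x ∧ expand a (hf₂ a b k) l))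
        ≡⟨ cong₂ (λ s t → Q xor ((a x ∧ s) xor (b x ∧ t)))
                 (hf₃-repeat a b k l) (expand-diag a (hf₁ b k) l) ⟩
      Q xor ((a x ∧ false) xor (b x ∧ false))
        ≡⟨ cong₂ (λ s t → Q xor (s xor t)) (∧-zeroʳ (a x)) (∧-zeroʳ (b x)) ⟩
      Q xor false
        ≡⟨ xor-identityʳ Q ⟩
      Q ∎

-- pm as a hafnian: summing the weights of all pairings of a vector, listed as
-- in Defs.pairings, is the hafnian expansion along the first entry.
module PairingSum {A : Set} (φ : A → A → Bool) where

  open Hafnian φ

  xsum : List Bool → Bool
  xsum = foldr _xor_ false

  weight : List (A × A) → Bool
  weight P = foldr _∧_ true (map (λ { (i , j) → φ i j }) P)

  xsum-++ : ∀ (s t : List Bool) → xsum (s ++ˡ t) ≡ xsum s xor xsum t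
  xsum-++ []      t = refl
  xsum-++ (c ∷ s) t = ≡-trans (cong (c xor_) (xsum-++ s t)) (≡-sym (xor-assoc c (xsum s) (xsum t)))

  xsum-concatMap : ∀ {C : Set} (g : C → List (List (A × A))) (cs : List C) →
    xsum (map weight (concatMap g cs)) ≡ xsum (map (λ c → xsum (map weight (g c))) cs)
  xsum-concatMap g []       = refl
  xsum-concatMap g (c ∷ cs) =
    ≡-trans (cong xsum (map-++ weight (g c) (concatMap g cs)))
            (≡-trans (xsum-++ (map weight (g c)) _) (cong (xsum (map weight (g c)) xor_) (xsum-concatMap g cs)))

  xsum-prefix : ∀ i j (Ps : List (List (A × A))) →
    xsum (map weight (map ((i , j) ∷_) Ps)) ≡ φ i j ∧ xsum (map weight Ps)
  xsum-prefix i j []       = ≡-sym (∧-zeroʳ (φ i j))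
  xsum-prefix i j (P ∷ Ps) =
    ≡-trans (cong ((φ i j ∧ weight P) xor_) (xsum-prefix i j Ps)) (≡-sym (∧-distribˡ-xor (φ i j) _ _))

  xsum-picks : ∀ {n} (v : Vec A (suc n)) (ρ : A → Bool) (F : List A → Bool) →
    xsum (map (λ q → ρ (proj₁ q) ∧ F (toList (proj₂ q))) (picks v)) ≡ expand ρ F (toList v)
  xsum-picks (x ∷ [])     ρ F = refl
  xsum-picks (x ∷ y ∷ xs) ρ F = cong ((ρ x ∧ F (y ∷ toList xs)) xor_)
    (≡-trans (cong xsum (≡-sym (map-∘ (picks (y ∷ xs)))))
             (xsum-picks (y ∷ xs) ρ (λ r → F (x ∷ r))))

  xsum-pairings : ∀ {n} (v : Vec A n) → xsum (map weight (pairings v)) ≡ hf ⌊ n /2⌋ (toList v)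
  xsum-pairings []               = refl
  xsum-pairings (x ∷ [])         = refl
  xsum-pairings {suc (suc n)} (x ∷ y ∷ xs) = begin
    xsum (map weight (concatMap g (picks (y ∷ xs))))
      ≡⟨ xsum-concatMap g (picks (y ∷ xs)) ⟩
    xsum (map (λ q → xsum (map weight (g q))) (picks (y ∷ xs)))
      ≡⟨ cong xsum (map-cong (λ q → ≡-trans (xsum-prefix x (proj₁ q) (pairings (proj₂ q)))
                                             (cong (φ x (proj₁ q) ∧_) (xsum-pairings (proj₂ q))))
                             (picks (y ∷ xs))) ⟩
    xsum (map (λ q → φ x (proj₁ q) ∧ hf ⌊ n /2⌋ (toList (proj₂ q))) (picks (y ∷ xs)))
      ≡⟨ xsum-picks (y ∷ xs) (φ x) (hf ⌊ n /2⌋) ⟩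
    hf ⌊ suc (suc n) /2⌋ (toList (x ∷ y ∷ xs)) ∎
    where
    open ≡-Reasoning
    g : A × Vec A n → List (List (A × A))
    g (z , r) = map ((x , z) ∷_) (pairings r)

∼-sym : ∀ {k} (H : SimpleGraph k) x y → x ∼[ H ] y ≡ y ∼[ H ] x
∼-sym H x y with x ≟ y | y ≟ x
... | yes _   | yes _   = cong (_∨ true) (SimpleGraph.sym H x y)
... | no _    | no _    = cong (_∨ false) (SimpleGraph.sym H x y)
... | yes x≡y | no y≢x  = contradiction (≡-sym x≡y) y≢x
... | no x≢y  | yes y≡x = contradiction (≡-sym y≡x) x≢y

pm-as-hafnian : ∀ {k m} (H : SimpleGraph k) (w : Vec (Fin k) m) →
  pm H w ≡ Hafnian.hf (λ x y → x ∼[ H ] y) ⌊ m /2⌋ (toList w)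
pm-as-hafnian {m = m} H w = begin
  pm H w
    ≡⟨ PairingSum.xsum-pairings (λ i j → lookup w i ∼[ H ] lookup w j) (allFin m) ⟩
  Hafnian.hf (λ i j → lookup w i ∼[ H ] lookup w j) ⌊ m /2⌋ (toList (allFin m))
    ≡⟨ Relabel.hf-map ∼H (lookup w) ⌊ m /2⌋ (toList (allFin m)) ⟩
  Hafnian.hf ∼H ⌊ m /2⌋ (map (lookup w) (toList (allFin m)))
    ≡⟨ cong (Hafnian.hf ∼H ⌊ m /2⌋) (≡-sym (toList-map (lookup w) (allFin m))) ⟩
  Hafnian.hf ∼H ⌊ m /2⌋ (toList (Vec.map (lookup w) (allFin m)))
    ≡⟨ cong (λ t → Hafnian.hf ∼H ⌊ m /2⌋ (toList t)) (map-lookup-allFin w) ⟩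
  Hafnian.hf ∼H ⌊ m /2⌋ (toList w) ∎
  where
  open ≡-Reasoning
  ∼H : Fin _ → Fin _ → Bool
  ∼H x y = x ∼[ H ] y

classOf : Bool → Bool → Cls
classOf true  false = c1
classOf false true  = c2
classOf true  true  = c3
classOf false false = none

cls-classOf : ∀ {k} (G : SimpleGraph k) u v x → cls G u v x ≡ classOf (u ∼[ G ] x) (v ∼[ G ] x)
cls-classOf G u v x with u ∼[ G ] x | v ∼[ G ] x
... | true  | false = refl
... | false | true  = refl
... | true  | true  = refl
... | false | false = refl

differ-classOf : ∀ p q p' q' → differ (classOf p q) (classOf p' q') ≡ (p ∧ q') xor (q ∧ p')
differ-classOf true  true  true  true  = refl
differ-classOf true  true  true  false = refl
differ-classOf true  true  false true  = refl
differ-classOf true  true  false false = refl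
differ-classOf true  false true  true  = refl
differ-classOf true  false true  false = refl
differ-classOf true  false false true  = refl
differ-classOf true  false false false = refl
differ-classOf false true  true  true  = refl
differ-classOf false true  true  false = refl
differ-classOf false true  false true  = refl
differ-classOf false true  false false = refl
differ-classOf false false true  true  = refl
differ-classOf false false true  false = refl
differ-classOf false false false true  = refl
differ-classOf false false false false = refl

pivot-∼ : ∀ {k} (G : SimpleGraph k) u v x y →
  x ∼[ pivot G u v ] y
    ≡ (x ∼[ G ] y) xor (((u ∼[ G ] x) ∧ (v ∼[ G ] y)) xor ((v ∼[ G ] x) ∧ (u ∼[ G ] y)))
pivot-∼ G u v x y with x ≟ y
... | yes refl = begin
  (adj G x x xor differ (cls G u v x) (cls G u v x)) ∨ true  ≡⟨ ∨-zeroʳ _ ⟩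
  true                                                        ≡⟨ ≡-sym (cong₂ _xor_ (∨-zeroʳ (adj G x x)) cross-term-vanishes) ⟩
  (adj G x x ∨ true) xor ((ax ∧ bx) xor (bx ∧ ax))            ∎
  where
  open ≡-Reasoning
  ax bx : Bool
  ax = u ∼[ G ] x
  bx = v ∼[ G ] x
  cross-term-vanishes : (ax ∧ bx) xor (bx ∧ ax) ≡ false
  cross-term-vanishes = ≡-trans (cong ((ax ∧ bx) xor_) (∧-comm bx ax)) (xor-same (ax ∧ bx))
... | no _ = begin
  (adj G x y xor differ (cls G u v x) (cls G u v y)) ∨ false
    ≡⟨ ∨-identityʳ _ ⟩
  adj G x y xor differ (cls G u v x) (cls G u v y)
    ≡⟨ cong₂ (λ s t → s xor differ t (cls G u v y)) (≡-sym (∨-identityʳ (adj G x y))) (cls-classOf G u v x) ⟩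
  (adj G x y ∨ false) xor differ (classOf ax bx) (cls G u v y)
    ≡⟨ cong (λ t → (adj G x y ∨ false) xor differ (classOf ax bx) t) (cls-classOf G u v y) ⟩
  (adj G x y ∨ false) xor differ (classOf ax bx) (classOf ay by)
    ≡⟨ cong ((adj G x y ∨ false) xor_) (differ-classOf ax bx ay by) ⟩
  (adj G x y ∨ false) xor ((ax ∧ by) xor (bx ∧ ay)) ∎
  where
  open ≡-Reasoning
  ax bx ay by : Bool
  ax = u ∼[ G ] x
  bx = v ∼[ G ] x
  ay = u ∼[ G ] y
  by = v ∼[ G ] y

theorem9 : ∀ {k : ℕ} (G : SimpleGraph k) (n : ℕ) → 2 ∣ n → (vs : Vec (Fin k) n)
    → (u v : Fin k) → adj G u v ≡ true
    → pm (pivot G u v) vs ≡ pm G (vs ++ (u ∷ v ∷ []))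
theorem9 G n _ vs u v uv-edge = begin
  pm (pivot G u v) vs
    ≡⟨ pm-as-hafnian (pivot G u v) vs ⟩
  Hafnian.hf (λ x y → x ∼[ pivot G u v ] y) m w
    ≡⟨ RankTwo.rank-two-update ∼G _ (u ∼[ G ]_) (v ∼[ G ]_) (pivot-∼ G u v) m w ⟩
  hf m w xor hf₂ (u ∼[ G ]_) (v ∼[ G ]_) m w
    ≡⟨ cong (λ t → (t ∧ hf m w) xor hf₂ (u ∼[ G ]_) (v ∼[ G ]_) m w) (≡-sym u∼v) ⟩
  ((u ∼[ G ] v) ∧ hf m w) xor hf₂ (u ∼[ G ]_) (v ∼[ G ]_) m w
    ≡⟨⟩
  hf (suc m) (u ∷ v ∷ w)
    ≡⟨ hf-↭ (suc m) (++-comm (u ∷ v ∷ []) w) ⟩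
  hf (suc m) (w ++ˡ (u ∷ v ∷ []))
    ≡⟨ cong₂ hf (cong ⌊_/2⌋ (+-comm 2 n)) (≡-sym (toList-++ vs (u ∷ v ∷ []))) ⟩
  hf ⌊ n + 2 /2⌋ (toList (vs ++ (u ∷ v ∷ [])))
    ≡⟨ ≡-sym (pm-as-hafnian G (vs ++ (u ∷ v ∷ []))) ⟩
  pm G (vs ++ (u ∷ v ∷ [])) ∎
  where
  open ≡-Reasoning
  ∼G : Fin _ → Fin _ → Bool
  ∼G x y = x ∼[ G ] y
  open Hafnian ∼G
  open Symmetric (∼-sym G)
  m : ℕ
  m = ⌊ n /2⌋
  w : List (Fin _)
  w = toList vs
  u∼v : u ∼[ G ] v ≡ true
  u∼v = cong (_∨ ⌊ u ≟ v ⌋) uv-edge
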